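{- Let $d,\ell,k\geq1$ be integers, let $v_1,\dots,v_\ell\in\mathbb{Z}^d$, and let $P_1,\dots,P_\ell\in\mathbb{Z}[r]$ with $\max_{1\leq j\leq\ell}\deg P_j\leq k$. There exists a constant $C$ (depending on the $v_j$ and $P_j$) such that if $N$ is a positive integer and $A\subseteq[1,N]^d$ with \[\frac{|A|}{N^d}\geq C\,N^{ -1/(\ell k)},\] then there exist $r',r''\in\mathbb{N}$ with $r'\neq r''$ such that \[\bigl\{(P_1(r')-P_1(r''))v_1,\dots,(P_\ell(r')-P_\ell(r''))v_\ell\bigr\}\subseteq A-A.\]
   Context: $[1,N]=\{1,\dots,N\}$ and $[1,N]^d$ its $d$-fold product; $A-A=\{a-a':a,a'\in A\}$. -}

module Defs where

open import Data.Nat using (ℕ)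
open import Data.Integer using (ℤ; +_; _+_; _*_; _-_; _≤_; 0ℤ)
open import Data.Vec using (Vec; []; _∷_; map; zipWith)
open import Data.List using (List)
open import Data.List.Relation.Unary.All using (All)
open import Data.List.Membership.Propositional using (_∈_)
open import Data.Product using (Σ; _×_; ∃; ∃-syntax)
open import Relation.Binary.PropositionalEquality using (_≡_)

Point : ℕ → Set
Point d = Vec ℤ d

-- A polynomial in ℤ[r] of degree ≤ k, given by its k+1 coefficients
-- c₀ ∷ c₁ ∷ … ∷ c_k  (representing c₀ + c₁ r + … + c_k r^k).
Poly≤ : ℕ → Set
Poly≤ k = Vec ℤ (Data.Nat.suc k)

eval : ∀ {n} → Vec ℤ n → ℤ → ℤ
eval []       x = 0ℤ
eval (c ∷ cs) x = c + x * eval cs x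

scale : ∀ {d} → ℤ → Point d → Point d
scale c v = map (c *_) v

vsub : ∀ {d} → Point d → Point d → Point d
vsub = zipWith _-_

InBox : ∀ {d} → ℕ → Point d → Set
InBox {d} N a = Data.Vec.Relation.Unary.All.All (λ x → (+ 1 ≤ x) × (x ≤ + N)) a
  where import Data.Vec.Relation.Unary.All

_∈Diff_ : ∀ {d} → Point d → List (Point d) → Set
x ∈Diff A = ∃[ a ] ∃[ a' ] (a ∈ A × a' ∈ A × x ≡ vsub a a')

{-# OPTIONS --safe #-}
-- Pigeonhole. Let K bound every ‖P_j‖₁ ‖v_j‖₁ and let R be maximal with K R^k ≤ N.
-- For r < R and a ∈ A^ℓ the tuple (a_j + P_j(r) v_j)_j has all coordinates in
-- [-2N, 2N], so the R |A|^ℓ such tuples lie in a box of at most (5N)^(dℓ) points.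
-- With C = 2^k K 5^(dℓk) the density hypothesis forces K ≤ N (so R ≥ 1) and makes
-- R |A|^ℓ exceed that number, so two tuples coincide. They cannot share r, since
-- a ↦ a + P(r) v is injective; hence r′ ≠ r″ and
-- (P_j(r′) - P_j(r″)) v_j = a″_j - a′_j ∈ A - A.
module Submission where

open import Defs
open import Data.Nat as ℕ
  using (ℕ; zero; suc; _+_; _*_; _^_; _≤_; _<_; s≤s; NonZero)
import Data.Nat.Properties as ℕ
open import Data.Integer as ℤ using (ℤ; +_; -[1+_]; ∣_∣; _-_)
import Data.Integer.Properties as ℤ
import Data.Integer.Tactic.RingSolver as ℤ-Solver
import Data.Nat.Tactic.RingSolver as ℕ-Solver
open import Data.Fin as Fin using (Fin)
import Data.Fin.Properties as Fin
open import Data.List as List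
  using (List; []; _∷_; [_]; length; upTo; cartesianProduct; cartesianProductWith)
import Data.List.Properties as List
open import Data.List.Membership.Propositional using (_∈_)
open import Data.List.Membership.Propositional.Properties
  using (∈-lookup; ∈-cartesianProductWith⁺; ∈-cartesianProductWith⁻;
         ∈-cartesianProduct⁻; ∈-upTo⁻)
open import Data.List.Relation.Binary.Subset.Propositional using (_⊆_)
open import Data.List.Relation.Unary.All as All using (All)
open import Data.List.Relation.Unary.Any as Any using (here; there)
import Data.List.Relation.Unary.Any.Properties as Any
open import Data.List.Relation.Unary.AllPairs using ([]; _∷_)
open import Data.List.Relation.Unary.Unique.Propositional using (Unique)
import Data.List.Relation.Unary.Unique.Propositional.Properties as Unique
open import Data.Vec as Vec using (Vec; []; _∷_; lookup; tabulate)
import Data.Vec.Properties as Vec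
import Data.Vec.Relation.Unary.All as VAll
import Data.Vec.Relation.Unary.All.Properties as VAll
open import Data.Vec.Relation.Binary.Pointwise.Extensional using (ext; Pointwise-≡⇒≡)
open import Data.Product using (_×_; _,_; proj₁; proj₂; ∃-syntax; ∃₂)
open import Data.Sum using (inj₁; inj₂)
open import Data.Empty using (⊥-elim)
open import Function using (_∘_)
open import Relation.Nullary using (yes; no)
open import Relation.Binary.PropositionalEquality
  using (_≡_; _≢_; refl; sym; trans; cong; cong₂; subst; subst₂; module ≡-Reasoning)

private
  variable
    X Y : Set

^-distribʳ-* : ∀ a b n → (a * b) ^ n ≡ a ^ n * b ^ n
^-distribʳ-* a b zero    = refl
^-distribʳ-* a b (suc n) = trans (cong (a * b *_) (^-distribʳ-* a b n)) (interchange a b (a ^ n) (b ^ n))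
  where
    interchange : ∀ a b x y → a * b * (x * y) ≡ a * x * (b * y)
    interchange = ℕ-Solver.solve-∀

m≤m^n : ∀ m n .{{_ : NonZero m}} .{{_ : NonZero n}} → m ≤ m ^ n
m≤m^n m (suc n) = ℕ.m≤m*n m (m ^ n) {{ℕ.m^n≢0 m n}}

^-cancelˡ-< : ∀ n {a b} → a ^ n < b ^ n → a < b
^-cancelˡ-< n aⁿ<bⁿ = ℕ.≰⇒> λ b≤a → ℕ.<⇒≱ aⁿ<bⁿ (ℕ.^-monoˡ-≤ n b≤a)

increasing⇒bracket : (g : ℕ → ℕ) → g 0 ≡ 0 → (∀ m → g m < g (suc m)) →
                     ∀ N → ∃[ R ] (g R ≤ N × N < g (suc R))
increasing⇒bracket g g0≡0 increasing zero = 0 , ℕ.≤-reflexive g0≡0 , subst (_< g 1) g0≡0 (increasing 0)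
increasing⇒bracket g g0≡0 increasing (suc N)
  with increasing⇒bracket g g0≡0 increasing N
... | R , gR≤N , N<gR+1 with g (suc R) ℕ.≤? suc N
...   | yes gR+1≤N+1 = suc R , gR+1≤N+1 , ℕ.≤-<-trans N<gR+1 (increasing (suc R))
...   | no  gR+1≰N+1 = R , ℕ.m≤n⇒m≤1+n gR≤N , ℕ.≰⇒> gR+1≰N+1

Fin-bounded : ∀ {ℓ} (f : Fin ℓ → ℕ) → ∃[ K ] (∀ j → f j ≤ K)
Fin-bounded {zero}  f = 0 , λ ()
Fin-bounded {suc ℓ} f =
  let K , bound = Fin-bounded (f ∘ Fin.suc) in
  f Fin.zero ℕ.⊔ K , λ { Fin.zero → ℕ.m≤m⊔n _ K ; (Fin.suc j) → ℕ.≤-trans (bound j) (ℕ.m≤n⊔m _ K) }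

Unique⇒lookup-injective : ∀ {xs : List X} → Unique xs →
                          ∀ i j → List.lookup xs i ≡ List.lookup xs j → i ≡ j
Unique⇒lookup-injective (_ ∷ _)     Fin.zero    Fin.zero    _  = refl
Unique⇒lookup-injective (x∉ ∷ _)    Fin.zero    (Fin.suc j) eq = ⊥-elim (All.lookup x∉ (∈-lookup j) eq)
Unique⇒lookup-injective (x∉ ∷ _)    (Fin.suc i) Fin.zero    eq = ⊥-elim (All.lookup x∉ (∈-lookup i) (sym eq))
Unique⇒lookup-injective (_ ∷ uniq)  (Fin.suc i) (Fin.suc j) eq =
  cong Fin.suc (Unique⇒lookup-injective uniq i j eq)

pigeonhole : ∀ {xs : List X} {ys : List Y} {f : X → Y} → Unique xs →
             (∀ {x} → x ∈ xs → f x ∈ ys) → length ys < length xs →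
             ∃₂ λ x x′ → x ∈ xs × x′ ∈ xs × x ≢ x′ × f x ≡ f x′
pigeonhole {xs = xs} {ys} {f} uniq maps-into shorter =
  let i , j , i<j , same-slot = Fin.pigeonhole shorter slot in
  List.lookup xs i , List.lookup xs j , ∈-lookup i , ∈-lookup j ,
    (λ eq → Fin.<-irrefl (Unique⇒lookup-injective uniq i j eq) i<j) ,
    trans (Any.lookup-index (member i))
          (trans (cong (List.lookup ys) same-slot) (sym (Any.lookup-index (member j))))
  where
    member : ∀ i → f (List.lookup xs i) ∈ ys
    member i = maps-into (∈-lookup i)
    slot : Fin (length xs) → Fin (length ys)
    slot i = Any.index (member i)

Unique-⊆⇒length≤ : ∀ {xs ys : List X} → Unique xs → xs ⊆ ys → length xs ≤ length ys
Unique-⊆⇒length≤ uniq xs⊆ys = ℕ.≮⇒≥ λ shorter →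
  let _ , _ , _ , _ , x≢x′ , x≡x′ = pigeonhole uniq xs⊆ys shorter in x≢x′ x≡x′

length-cartesianProductWith : ∀ {Z : Set} (f : X → Y → Z) xs ys →
  length (cartesianProductWith f xs ys) ≡ length xs * length ys
length-cartesianProductWith f []       ys = refl
length-cartesianProductWith f (x ∷ xs) ys = begin
  length (List.map (f x) ys List.++ cartesianProductWith f xs ys)
    ≡⟨ List.length-++ (List.map (f x) ys) ⟩
  length (List.map (f x) ys) + length (cartesianProductWith f xs ys)
    ≡⟨ cong₂ _+_ (List.length-map (f x) ys) (length-cartesianProductWith f xs ys) ⟩
  length ys + length xs * length ys ∎
  where open ≡-Reasoning

vectorsOver : List X → (m : ℕ) → List (Vec X m)
vectorsOver xs zero    = [ [] ]
vectorsOver xs (suc m) = cartesianProductWith _∷_ xs (vectorsOver xs m)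

length-vectorsOver : ∀ (xs : List X) m → length (vectorsOver xs m) ≡ length xs ^ m
length-vectorsOver xs zero    = refl
length-vectorsOver xs (suc m) =
  trans (length-cartesianProductWith _∷_ xs (vectorsOver xs m))
        (cong (length xs *_) (length-vectorsOver xs m))

∈-vectorsOver⁺ : ∀ {xs : List X} {m} {v : Vec X m} → VAll.All (_∈ xs) v → v ∈ vectorsOver xs m
∈-vectorsOver⁺ VAll.[]         = here refl
∈-vectorsOver⁺ (x∈ VAll.∷ v∈) = ∈-cartesianProductWith⁺ _∷_ x∈ (∈-vectorsOver⁺ v∈)

∈-vectorsOver⁻ : ∀ (xs : List X) {m} {v : Vec X m} → v ∈ vectorsOver xs m → VAll.All (_∈ xs) v
∈-vectorsOver⁻ xs {zero}  {[]} _ = VAll.[]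
∈-vectorsOver⁻ xs {suc m} v∈
  with _ , _ , x∈ , w∈ , refl ← ∈-cartesianProductWith⁻ _∷_ xs (vectorsOver xs m) v∈
  = x∈ VAll.∷ ∈-vectorsOver⁻ xs w∈

vectorsOver⁺ : ∀ {xs : List X} {m} → Unique xs → Unique (vectorsOver xs m)
vectorsOver⁺ {m = zero}  _    = All.[] ∷ []
vectorsOver⁺ {m = suc m} uniq =
  Unique.cartesianProductWith⁺ _∷_ Vec.∷-injective uniq (vectorsOver⁺ uniq)

symmetricRange : ℕ → List ℤ
symmetricRange zero    = [ + 0 ]
symmetricRange (suc B) = + suc B ∷ -[1+ B ] ∷ symmetricRange B

length-symmetricRange : ∀ B → length (symmetricRange B) ≡ suc (B + B)
length-symmetricRange zero    = refl
length-symmetricRange (suc B) =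
  cong (suc ∘ suc) (trans (length-symmetricRange B) (sym (ℕ.+-suc B B)))

∈-symmetricRange : ∀ {B x} → ∣ x ∣ ≤ B → x ∈ symmetricRange B
∈-symmetricRange {zero}  {+ zero}    _ = here refl
∈-symmetricRange {suc B} {+ n}       ∣x∣≤ with ℕ.m≤n⇒m<n∨m≡n ∣x∣≤
... | inj₂ refl      = here refl
... | inj₁ (s≤s n≤B) = there (there (∈-symmetricRange n≤B))
∈-symmetricRange {suc B} { -[1+ n ]} (s≤s n≤B) with ℕ.m≤n⇒m<n∨m≡n n≤B
... | inj₂ refl = there (here refl)
... | inj₁ n<B  = there (there (∈-symmetricRange n<B))

vadd : ∀ {d} → Point d → Point d → Point d
vadd = Vec.zipWith ℤ._+_

vadd-cancelʳ : ∀ {d} {a a′ : Point d} (x : Point d) → vadd a x ≡ vadd a′ x → a ≡ a′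
vadd-cancelʳ {a = []}    {[]}      []      _  = refl
vadd-cancelʳ {a = a ∷ _} {a′ ∷ _} (x ∷ xs) eq = cong₂ _∷_
  (begin
    a           ≡⟨ cancel a x ⟩
    a ℤ.+ x - x  ≡⟨ cong (_- x) (Vec.∷-injectiveˡ eq) ⟩
    a′ ℤ.+ x - x ≡⟨ sym (cancel a′ x) ⟩
    a′          ∎)
  (vadd-cancelʳ xs (Vec.∷-injectiveʳ eq))
  where
    open ≡-Reasoning
    cancel : ∀ a x → a ≡ a ℤ.+ x - x
    cancel = ℤ-Solver.solve-∀

vadd≡vadd⇒vsub≡vsub : ∀ {d} {a a′ x x′ : Point d} →
                       vadd a x ≡ vadd a′ x′ → vsub x x′ ≡ vsub a′ a
vadd≡vadd⇒vsub≡vsub {a = []} {[]} {[]} {[]} _ = refl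
vadd≡vadd⇒vsub≡vsub {a = a ∷ _} {a′ ∷ _} {x ∷ _} {x′ ∷ _} eq = cong₂ _∷_
  (begin
    x - x′                     ≡⟨ shift a x x′ ⟩
    (a ℤ.+ x) - (a ℤ.+ x′)      ≡⟨ cong (_- (a ℤ.+ x′)) (Vec.∷-injectiveˡ eq) ⟩
    (a′ ℤ.+ x′) - (a ℤ.+ x′)    ≡⟨ unshift a a′ x′ ⟩
    a′ - a                     ∎)
  (vadd≡vadd⇒vsub≡vsub (Vec.∷-injectiveʳ eq))
  where
    open ≡-Reasoning
    shift : ∀ a x x′ → x - x′ ≡ (a ℤ.+ x) - (a ℤ.+ x′)
    shift = ℤ-Solver.solve-∀
    unshift : ∀ a a′ x′ → (a′ ℤ.+ x′) - (a ℤ.+ x′) ≡ a′ - a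
    unshift = ℤ-Solver.solve-∀

scale-distribʳ-vsub : ∀ {d} p q (w : Point d) → scale (p - q) w ≡ vsub (scale p w) (scale q w)
scale-distribʳ-vsub p q []      = refl
scale-distribʳ-vsub p q (x ∷ w) = cong₂ _∷_ (distrib p q x) (scale-distribʳ-vsub p q w)
  where
    distrib : ∀ p q x → (p - q) ℤ.* x ≡ p ℤ.* x - q ℤ.* x
    distrib = ℤ-Solver.solve-∀

Bounded : ℕ → ∀ {d} → Point d → Set
Bounded B = VAll.All (λ x → ∣ x ∣ ≤ B)

InBox⇒Bounded : ∀ {d N} {a : Point d} → InBox N a → Bounded N a
InBox⇒Bounded = VAll.map λ { (_ , ℤ.+≤+ n≤N) → n≤N }

Bounded-mono : ∀ {d M M′} {a : Point d} → M ≤ M′ → Bounded M a → Bounded M′ a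
Bounded-mono M≤M′ = VAll.map λ ∣x∣≤M → ℕ.≤-trans ∣x∣≤M M≤M′

∈-box : ∀ {d B} {a : Point d} → Bounded B a → a ∈ vectorsOver (symmetricRange B) d
∈-box = ∈-vectorsOver⁺ ∘ VAll.map ∈-symmetricRange

length-box : ∀ d B → length (vectorsOver (symmetricRange B) d) ≡ suc (B + B) ^ d
length-box d B = trans (length-vectorsOver _ d) (cong (_^ d) (length-symmetricRange B))

Unique-InBox⇒length≤ : ∀ {d N} {A : List (Point d)} → Unique A → All (InBox N) A →
                       length A ≤ suc (N + N) ^ d
Unique-InBox⇒length≤ {d} {N} uniq inBox = ℕ.≤-trans
  (Unique-⊆⇒length≤ uniq λ a∈A → ∈-box (InBox⇒Bounded (All.lookup inBox a∈A)))
  (ℕ.≤-reflexive (length-box d N))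

vadd-bounded : ∀ {d M M′} {a x : Point d} → Bounded M a → Bounded M′ x → Bounded (M + M′) (vadd a x)
vadd-bounded VAll.[]               VAll.[]               = VAll.[]
vadd-bounded {a = a ∷ _} {x ∷ _} (∣a∣≤ VAll.∷ as) (∣x∣≤ VAll.∷ xs) =
  ℕ.≤-trans (ℤ.∣i+j∣≤∣i∣+∣j∣ a x) (ℕ.+-mono-≤ ∣a∣≤ ∣x∣≤) VAll.∷ vadd-bounded as xs

scale-bounded : ∀ {d V} p {w : Point d} → Bounded V w → Bounded (∣ p ∣ * V) (scale p w)
scale-bounded p = VAll.map⁺ ∘ VAll.map λ {x} ∣x∣≤ →
  ℕ.≤-trans (ℕ.≤-reflexive (ℤ.abs-* p x)) (ℕ.*-monoʳ-≤ ∣ p ∣ ∣x∣≤)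

‖_‖₁ : ∀ {n} → Vec ℤ n → ℕ
‖ cs ‖₁ = Vec.sum (Vec.map ∣_∣ cs)

bounded-‖‖₁ : ∀ {d} (w : Point d) → Bounded ‖ w ‖₁ w
bounded-‖‖₁ []      = VAll.[]
bounded-‖‖₁ (x ∷ w) =
  ℕ.m≤m+n ∣ x ∣ _ VAll.∷ VAll.map (λ ∣y∣≤ → ℕ.≤-trans ∣y∣≤ (ℕ.m≤n+m _ ∣ x ∣)) (bounded-‖‖₁ w)

∣eval∣≤‖‖₁*^ : ∀ {k} (cs : Poly≤ k) {x X} .{{_ : NonZero X}} → x ≤ X →
               ∣ eval cs (+ x) ∣ ≤ ‖ cs ‖₁ * X ^ k
∣eval∣≤‖‖₁*^ (c ∷ []) {x} x≤X = ℕ.≤-reflexive (begin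
  ∣ c ℤ.+ + x ℤ.* + 0 ∣ ≡⟨ cong (λ t → ∣ c ℤ.+ t ∣) (ℤ.*-zeroʳ (+ x)) ⟩
  ∣ c ℤ.+ + 0 ∣         ≡⟨ cong ∣_∣ (ℤ.+-identityʳ c) ⟩
  ∣ c ∣                 ≡⟨ sym (trans (ℕ.*-identityʳ _) (ℕ.+-identityʳ _)) ⟩
  (∣ c ∣ + 0) * 1       ∎)
  where open ≡-Reasoning
∣eval∣≤‖‖₁*^ {suc k} (c ∷ cs) {x} {X} x≤X = begin
  ∣ c ℤ.+ + x ℤ.* eval cs (+ x) ∣       ≤⟨ ℤ.∣i+j∣≤∣i∣+∣j∣ c _ ⟩
  ∣ c ∣ + ∣ + x ℤ.* eval cs (+ x) ∣     ≡⟨ cong (λ t → ∣ c ∣ + t) (ℤ.abs-* (+ x) _) ⟩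
  ∣ c ∣ + x * ∣ eval cs (+ x) ∣         ≤⟨ ℕ.+-mono-≤ (ℕ.m≤m*n ∣ c ∣ (X ^ suc k) {{ℕ.m^n≢0 X (suc k)}})
                                                      (ℕ.*-mono-≤ x≤X (∣eval∣≤‖‖₁*^ cs x≤X)) ⟩
  ∣ c ∣ * X ^ suc k + X * (‖ cs ‖₁ * X ^ k) ≡⟨ regroup ∣ c ∣ ‖ cs ‖₁ X (X ^ k) ⟩
  (∣ c ∣ + ‖ cs ‖₁) * X ^ suc k        ∎
  where
    open ℕ.≤-Reasoning
    regroup : ∀ a b X Y → a * (X * Y) + X * (b * Y) ≡ (a + b) * (X * Y)
    regroup = ℕ-Solver.solve-∀

module Translates {d ℓ : ℕ} (s : ℕ → Fin ℓ → Point d) where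

  translate : ℕ → Vec (Point d) ℓ → Vec (Point d) ℓ
  translate r as = tabulate λ j → vadd (lookup as j) (s r j)

  translate≡⇒vadd≡ : ∀ {r r′} as as′ → translate r as ≡ translate r′ as′ →
                     ∀ j → vadd (lookup as j) (s r j) ≡ vadd (lookup as′ j) (s r′ j)
  translate≡⇒vadd≡ _ _ eq j = trans (sym (Vec.lookup∘tabulate _ j))
    (trans (cong (λ t → lookup t j) eq) (Vec.lookup∘tabulate _ j))

  translate-injectiveʳ : ∀ {r as as′} → translate r as ≡ translate r as′ → as ≡ as′
  translate-injectiveʳ {r} {as} {as′} eq =
    Pointwise-≡⇒≡ (ext λ j → vadd-cancelʳ (s r j) (translate≡⇒vadd≡ as as′ eq j))

  -- Pigeonhole on the R · |A|^ℓ pairs (r, a); a collision with equal r would force equal a.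
  ∃-shift-differences : ∀ {A : List (Point d)} → Unique A → ∀ R B →
    (∀ {r a} j → r < R → a ∈ A → Bounded B (vadd a (s r j))) →
    (suc (B + B) ^ d) ^ ℓ < R * length A ^ ℓ →
    ∃[ r′ ] ∃[ r″ ] (r′ ≢ r″ × ∀ j → vsub (s r′ j) (s r″ j) ∈Diff A)
  ∃-shift-differences {A} uniq R B bounded many
    with pigeonhole {f = λ (r , as) → translate r as}
           (Unique.cartesianProduct⁺ (Unique.upTo⁺ R) (vectorsOver⁺ uniq))
           translate∈box
           (subst₂ _<_ (sym box-size) (sym domain-size) many)
    where
      domain = cartesianProduct (upTo R) (vectorsOver A ℓ)
      box    = vectorsOver (vectorsOver (symmetricRange B) d) ℓ

      translate∈box : ∀ {x} → x ∈ domain → translate (proj₁ x) (proj₂ x) ∈ box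
      translate∈box {r , as} x∈ =
        let r∈ , as∈ = ∈-cartesianProduct⁻ (upTo R) _ x∈ in
        ∈-vectorsOver⁺ (VAll.tabulate⁺ λ j →
          ∈-box (bounded j (∈-upTo⁻ r∈) (VAll.lookup⁺ (∈-vectorsOver⁻ A as∈) j)))

      box-size : length box ≡ (suc (B + B) ^ d) ^ ℓ
      box-size = trans (length-vectorsOver _ ℓ) (cong (_^ ℓ) (length-box d B))

      domain-size : length domain ≡ R * length A ^ ℓ
      domain-size = trans (length-cartesianProductWith _,_ (upTo R) _)
        (cong₂ _*_ (List.length-upTo R) (length-vectorsOver A ℓ))
  ... | (r , as) , (r′ , as′) , x∈ , x′∈ , x≢x′ , same with r ℕ.≟ r′
  ...   | yes refl = ⊥-elim (x≢x′ (cong (r ,_) (translate-injectiveʳ same)))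
  ...   | no r≢r′  = r , r′ , r≢r′ , λ j →
          lookup as′ j , lookup as j , member x′∈ j , member x∈ j ,
          vadd≡vadd⇒vsub≡vsub (translate≡⇒vadd≡ as as′ same j)
    where
      member : ∀ {r as} → (r , as) ∈ cartesianProduct (upTo R) (vectorsOver A ℓ) → ∀ j → lookup as j ∈ A
      member as∈ = VAll.lookup⁺ (∈-vectorsOver⁻ A (proj₂ (∈-cartesianProduct⁻ (upTo R) _ as∈)))

1+2B≤5N : ∀ {B N} .{{_ : NonZero N}} → B ≤ N + N → suc (B + B) ≤ 5 * N
1+2B≤5N {B} {N} B≤2N = begin
  suc (B + B)             ≤⟨ s≤s (ℕ.+-mono-≤ B≤2N B≤2N) ⟩
  1 + ((N + N) + (N + N)) ≤⟨ ℕ.+-monoˡ-≤ _ (ℕ.>-nonZero⁻¹ N) ⟩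
  N + ((N + N) + (N + N)) ≡⟨ five N ⟩
  5 * N                   ∎
  where
    open ℕ.≤-Reasoning
    five : ∀ N → N + ((N + N) + (N + N)) ≡ 5 * N
    five = ℕ-Solver.solve-∀

module DensityConstant (d ℓ k K : ℕ) .{{_ : NonZero ℓ}} .{{_ : NonZero k}} .{{_ : NonZero K}} where

  m = ℓ * k
  e = d * m
  C = 2 ^ k * K * 5 ^ e

  instance
    m≢0 : NonZero m
    m≢0 = ℕ.m*n≢0 ℓ k
    C≢0 : NonZero C
    C≢0 = ℕ.m*n≢0 (2 ^ k * K) (5 ^ e) {{ℕ.m*n≢0 (2 ^ k) K {{ℕ.m^n≢0 2 k}}}} {{ℕ.m^n≢0 5 e}}

  5ᵉK≤Cᵐ : 5 ^ e * K ≤ C ^ m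
  5ᵉK≤Cᵐ = begin
    5 ^ e * K       ≤⟨ ℕ.m≤n*m (5 ^ e * K) (2 ^ k) {{ℕ.m^n≢0 2 k}} ⟩
    2 ^ k * (5 ^ e * K) ≡⟨ rearrange (2 ^ k) (5 ^ e) K ⟩
    C               ≤⟨ m≤m^n C m ⟩
    C ^ m           ∎
    where
      open ℕ.≤-Reasoning
      rearrange : ∀ a b c → a * (b * c) ≡ a * c * b
      rearrange = ℕ-Solver.solve-∀

  dense⇒K≤N : ∀ {N n} .{{_ : NonZero N}} → n ≤ suc (N + N) ^ d →
              C ^ m * N ^ e ≤ n ^ m * N → K ≤ N
  dense⇒K≤N {N} {n} n≤ dense =
    ℕ.*-cancelˡ-≤ (5 ^ e) {{ℕ.m^n≢0 5 e}} (ℕ.*-cancelʳ-≤ _ _ (N ^ e) {{ℕ.m^n≢0 N e}} (begin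
      5 ^ e * K * N ^ e          ≤⟨ ℕ.*-monoˡ-≤ (N ^ e) 5ᵉK≤Cᵐ ⟩
      C ^ m * N ^ e              ≤⟨ dense ⟩
      n ^ m * N                  ≤⟨ ℕ.*-monoˡ-≤ N (ℕ.^-monoˡ-≤ m (ℕ.≤-trans n≤ (ℕ.^-monoˡ-≤ d (1+2B≤5N (ℕ.m≤m+n N N))))) ⟩
      ((5 * N) ^ d) ^ m * N      ≡⟨ cong (_* N) (trans (ℕ.^-*-assoc (5 * N) d m) (^-distribʳ-* 5 N e)) ⟩
      5 ^ e * N ^ e * N          ≡⟨ swap (5 ^ e) (N ^ e) N ⟩
      5 ^ e * N * N ^ e          ∎))
    where
      open ℕ.≤-Reasoning
      swap : ∀ a b c → a * b * c ≡ a * c * b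
      swap = ℕ-Solver.solve-∀

  dense⇒tuples-outnumber-box : ∀ {N n R} .{{_ : NonZero N}} .{{_ : NonZero R}} →
    K * R ^ k ≤ N → N < K * suc R ^ k → C ^ m * N ^ e ≤ n ^ m * N →
    let B = N + K * R ^ k in (suc (B + B) ^ d) ^ ℓ < R * n ^ ℓ
  dense⇒tuples-outnumber-box {N} {n} {R} KRᵏ≤N N<K[R+1]ᵏ dense = ^-cancelˡ-< k (begin-strict
    ((suc (B + B) ^ d) ^ ℓ) ^ k ≡⟨ trans (cong (_^ k) (ℕ.^-*-assoc _ d ℓ))
                                   (trans (ℕ.^-*-assoc _ (d * ℓ) k) (cong (suc (B + B) ^_) (ℕ.*-assoc d ℓ k))) ⟩
    suc (B + B) ^ e             ≤⟨ ℕ.^-monoˡ-≤ e (1+2B≤5N (ℕ.+-monoʳ-≤ N KRᵏ≤N)) ⟩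
    (5 * N) ^ e                 ≡⟨ ^-distribʳ-* 5 N e ⟩
    5 ^ e * N ^ e               <⟨ 5ᵉNᵉ<Rᵏnᵐ ⟩
    R ^ k * n ^ m               ≡⟨ cong (R ^ k *_) (sym (ℕ.^-*-assoc n ℓ k)) ⟩
    R ^ k * (n ^ ℓ) ^ k         ≡⟨ sym (^-distribʳ-* R (n ^ ℓ) k) ⟩
    (R * n ^ ℓ) ^ k             ∎)
    where
      open ℕ.≤-Reasoning
      B = N + K * R ^ k

      5ᵉN<RᵏCᵐ : 5 ^ e * N < R ^ k * C ^ m
      5ᵉN<RᵏCᵐ = begin-strict
        5 ^ e * N                   <⟨ ℕ.*-monoʳ-< (5 ^ e) {{ℕ.m^n≢0 5 e}} N<K[R+1]ᵏ ⟩
        5 ^ e * (K * suc R ^ k)     ≤⟨ ℕ.*-monoʳ-≤ (5 ^ e) (ℕ.*-monoʳ-≤ K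
                                         (ℕ.^-monoˡ-≤ k (ℕ.+-monoˡ-≤ R (ℕ.>-nonZero⁻¹ R)))) ⟩
        5 ^ e * (K * (R + R) ^ k)   ≡⟨ cong (λ t → 5 ^ e * (K * t ^ k)) (double R) ⟩
        5 ^ e * (K * (2 * R) ^ k)   ≡⟨ cong (λ t → 5 ^ e * (K * t)) (^-distribʳ-* 2 R k) ⟩
        5 ^ e * (K * (2 ^ k * R ^ k)) ≡⟨ rearrange (5 ^ e) K (2 ^ k) (R ^ k) ⟩
        R ^ k * C                   ≤⟨ ℕ.*-monoʳ-≤ (R ^ k) (m≤m^n C m) ⟩
        R ^ k * C ^ m               ∎
        where
          double : ∀ R → R + R ≡ 2 * R
          double = ℕ-Solver.solve-∀
          rearrange : ∀ a K b x → a * (K * (b * x)) ≡ x * (b * K * a)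
          rearrange = ℕ-Solver.solve-∀

      5ᵉNᵉ<Rᵏnᵐ : 5 ^ e * N ^ e < R ^ k * n ^ m
      5ᵉNᵉ<Rᵏnᵐ = ℕ.*-cancelʳ-< N _ _ (begin-strict
        5 ^ e * N ^ e * N       ≡⟨ swap (5 ^ e) (N ^ e) N ⟩
        5 ^ e * N * N ^ e       <⟨ ℕ.*-monoˡ-< (N ^ e) {{ℕ.m^n≢0 N e}} 5ᵉN<RᵏCᵐ ⟩
        R ^ k * C ^ m * N ^ e   ≡⟨ ℕ.*-assoc (R ^ k) (C ^ m) (N ^ e) ⟩
        R ^ k * (C ^ m * N ^ e) ≤⟨ ℕ.*-monoʳ-≤ (R ^ k) dense ⟩
        R ^ k * (n ^ m * N)     ≡⟨ sym (ℕ.*-assoc (R ^ k) (n ^ m) N) ⟩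
        R ^ k * n ^ m * N       ∎)
        where
          swap : ∀ a b c → a * b * c ≡ a * c * b
          swap = ℕ-Solver.solve-∀

scale-eval-bounded : ∀ {d k K R r} (p : Poly≤ k) (w : Point d) .{{_ : NonZero R}} →
                     ‖ p ‖₁ * ‖ w ‖₁ ≤ K → r ≤ R → Bounded (K * R ^ k) (scale (eval p (+ r)) w)
scale-eval-bounded {k = k} {K} {R} {r} p w bound r≤R =
  Bounded-mono (begin
    ∣ eval p (+ r) ∣ * ‖ w ‖₁ ≤⟨ ℕ.*-monoˡ-≤ ‖ w ‖₁ (∣eval∣≤‖‖₁*^ p r≤R) ⟩
    ‖ p ‖₁ * R ^ k * ‖ w ‖₁   ≡⟨ swap ‖ p ‖₁ (R ^ k) ‖ w ‖₁ ⟩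
    ‖ p ‖₁ * ‖ w ‖₁ * R ^ k   ≤⟨ ℕ.*-monoˡ-≤ (R ^ k) bound ⟩
    K * R ^ k                 ∎)
  (scale-bounded (eval p (+ r)) (bounded-‖‖₁ w))
  where
    open ℕ.≤-Reasoning
    swap : ∀ a b c → a * b * c ≡ a * c * b
    swap = ℕ-Solver.solve-∀

HasPolynomialDifferences : ∀ {d ℓ k} → (Fin ℓ → Point d) → (Fin ℓ → Poly≤ k) → List (Point d) → Set
HasPolynomialDifferences {ℓ = ℓ} v P A = ∃[ r′ ] ∃[ r″ ] ((r′ ≢ r″) ×
  ((j : Fin ℓ) → scale (eval (P j) (+ r′) - eval (P j) (+ r″)) (v j) ∈Diff A))

theorem3p2 : (d ℓ k : ℕ) → 1 ≤ d → 1 ≤ ℓ → 1 ≤ k →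
    (v : Fin ℓ → Point d) → (P : Fin ℓ → Poly≤ k) →
    ∃[ C ] ((N : ℕ) → 1 ≤ N → (A : List (Point d)) → Unique A → All (InBox N) A →
      C ^ (ℓ * k) * N ^ (d * (ℓ * k)) ≤ length A ^ (ℓ * k) * N →
      ∃[ r′ ] ∃[ r″ ] ((r′ ≢ r″) ×
        ((j : Fin ℓ) →
          scale (eval (P j) (+ r′) - eval (P j) (+ r″)) (v j) ∈Diff A)))
theorem3p2 d ℓ@(suc _) k@(suc _) _ _ _ v P = C , dense⇒differences
  where
    weight : Fin ℓ → ℕ
    weight j = ‖ P j ‖₁ * ‖ v j ‖₁
    K = suc (proj₁ (Fin-bounded weight))
    open DensityConstant d ℓ k K
    open Translates (λ r j → scale (eval (P j) (+ r)) (v j))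

    increasing : ∀ R → K * R ^ k < K * suc R ^ k
    increasing R = ℕ.*-monoʳ-< K (ℕ.^-monoˡ-< k (ℕ.n<1+n R))

    shifts-bounded : ∀ {N R r a} .{{_ : NonZero R}} j → r < R → InBox N a →
                     Bounded (N + K * R ^ k) (vadd a (scale (eval (P j) (+ r)) (v j)))
    shifts-bounded j r<R a∈box = vadd-bounded (InBox⇒Bounded a∈box)
      (scale-eval-bounded (P j) (v j) (ℕ.m≤n⇒m≤1+n (proj₂ (Fin-bounded weight) j)) (ℕ.<⇒≤ r<R))

    dense⇒differences : (N : ℕ) → 1 ≤ N → (A : List (Point d)) → Unique A → All (InBox N) A →
                        C ^ m * N ^ e ≤ length A ^ m * N → HasPolynomialDifferences v P A
    dense⇒differences N@(suc _) _ A uniq inBox dense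
      with increasing⇒bracket (λ R → K * R ^ k) (ℕ.*-zeroʳ K) increasing N
    ... | zero , _ , N<K*1ᵏ = ⊥-elim (ℕ.<⇒≱ N<K (dense⇒K≤N (Unique-InBox⇒length≤ uniq inBox) dense))
      where
        N<K : N < K
        N<K = subst (N <_) (trans (cong (K *_) (ℕ.^-zeroˡ k)) (ℕ.*-identityʳ K)) N<K*1ᵏ
    ... | R@(suc _) , KRᵏ≤N , N<K[R+1]ᵏ =
      let r′ , r″ , r′≢r″ , differences = ∃-shift-differences uniq R (N + K * R ^ k)
            (λ j r<R a∈A → shifts-bounded j r<R (All.lookup inBox a∈A))
            (dense⇒tuples-outnumber-box {n = length A} KRᵏ≤N N<K[R+1]ᵏ dense)
      in r′ , r″ , r′≢r″ , λ j → subst (_∈Diff A)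
           (sym (scale-distribʳ-vsub (eval (P j) (+ r′)) (eval (P j) (+ r″)) (v j))) (differences j)
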